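{- Let $G$ be a finite simple undirected connected graph and $M$ a prefix matching of $\Gamma$. Suppose that in $\Gamma^M$ there is a directed cycle $a_1\to b_1\to a_2\to b_2\to\cdots\to a_p\to b_p\to a_{p+1}=a_1$, where each $a_i$ is a sequence of length $k+1$, each $b_i$ a sequence of length $k$, each edge $a_i\to b_i$ is an (unmatched) edge of $\Gamma$ with $b_i$ obtained from $a_i$ by deleting the entry of index $d_i$, and each edge $b_i\to a_{i+1}$ is a reversed matched edge with $a_{i+1}$ obtained from $b_i=(b_{i,0},\ldots,b_{i,k-1})$ by inserting a vertex $u_i$ between positions $c_i$ and $c_i+1$, i.e. $a_{i+1}=(b_{i,0},\ldots,b_{i,c_i},u_i,b_{i,c_i+1},\ldots,b_{i,k-1})$. Indices are taken mod $p$. Then for all $i$: $d_{i+1}\ne c_i+1$, $d_{i+1}\le c_i+2$, and $d_i\le c_i+1$.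
   Context: $d$ is the shortest-path metric of $G$, $\ell(x_0,\ldots,x_k)=\sum_{i=0}^{k-1}d(x_i,x_{i+1})$. A "sequence" means a tuple $(x_0,\ldots,x_k)\in V(G)^{k+1}$ ($k\ge 0$) with $x_i\ne x_{i+1}$ for all $i$. Let $\Gamma$ be the directed graph whose vertices are all sequences and with an edge $a\to b$ whenever $a=(x_0,\ldots,x_k)$ and $b=(x_0,\ldots,\hat x_i,\ldots,x_k)$ for some $1\le i\le k-1$ with $\ell(b)=\ell(a)$. A matching is a set of edges of $\Gamma$, no two sharing an endpoint; $\Gamma^M$ denotes $\Gamma$ with the edges of $M$ reversed. Relative to a matching, the matching state of a sequence $(x_0,\ldots,x_k)$ is: unmatched; insert$(i,v)$ if it is matched to $(x_0,\ldots,x_i,v,x_{i+1},\ldots,x_k)$; or delete$(i)$ if it is matched to $(x_0,\ldots,\hat x_i,\ldots,x_k)$. A prefix matching is a matching such that: if $(x_0,\ldots,x_k)$ has state insert$(i,v)$ (resp. delete$(i)$), then every sequence of the form $(x_0,\ldots,x_{i+1},y_{i+2},\ldots,y_{k'})$ has state insert$(i,v)$ (resp. delete$(i)$). -}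

module Defs where

open import Data.Nat using (ℕ; zero; suc; _+_; _≤_; _<_)
open import Data.Fin using (Fin)
open import Data.List using (List; []; _∷_; length; take; _++_)
open import Data.Product using (Σ; ∃; _×_; _,_)
open import Data.Sum using (_⊎_)
open import Relation.Nullary using (¬_)
open import Relation.Binary.PropositionalEquality using (_≡_)

record Graph (n : ℕ) : Set₁ where
  field
    Adj   : Fin n → Fin n → Set
    irrefl : ∀ x → ¬ Adj x x
    sym    : ∀ {x y} → Adj x y → Adj y x

data Walk {n : ℕ} (G : Graph n) : Fin n → Fin n → ℕ → Set where
  here : ∀ x → Walk G x x zero
  step : ∀ {x y z m} → Graph.Adj G x y → Walk G y z m → Walk G x z (suc m)

Connected : ∀ {n} → Graph n → Set
Connected G = ∀ x y → ∃ λ m → Walk G x y m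

IsShortestPathMetric : ∀ {n} → Graph n → (Fin n → Fin n → ℕ) → Set
IsShortestPathMetric G d =
  ∀ x y → Walk G x y (d x y) × (∀ m → Walk G x y m → d x y ≤ m)

data NoRep {A : Set} : List A → Set where
  nil  : NoRep []
  one  : ∀ x → NoRep (x ∷ [])
  cons : ∀ {x y xs} → ¬ x ≡ y → NoRep (y ∷ xs) → NoRep (x ∷ y ∷ xs)

IsSeq : ∀ {A : Set} → List A → Set
IsSeq xs = (1 ≤ length xs) × NoRep xs

len : ∀ {n} → (Fin n → Fin n → ℕ) → List (Fin n) → ℕ
len d []           = 0
len d (x ∷ [])     = 0
len d (x ∷ y ∷ xs) = d x y + len d (y ∷ xs)

-- delete the entry of index i (0-based)
del : ∀ {A : Set} → List A → ℕ → List A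
del []       i       = []
del (x ∷ xs) zero    = xs
del (x ∷ xs) (suc i) = x ∷ del xs i

-- insert v so that it gets index i (0-based), i.e. between positions i-1 and i
ins : ∀ {A : Set} → List A → ℕ → A → List A
ins xs       zero    v = v ∷ xs
ins []       (suc i) v = v ∷ []
ins (x ∷ xs) (suc i) v = x ∷ ins xs i v

Edge : ∀ {n} → (Fin n → Fin n → ℕ) → List (Fin n) → List (Fin n) → Set
Edge d a b = IsSeq a × IsSeq b ×
  (Σ ℕ λ i → (1 ≤ i) × (suc i < length a) × (b ≡ del a i) × (len d b ≡ len d a))

record IsMatching {n} (d : Fin n → Fin n → ℕ) (M : List (Fin n) → List (Fin n) → Set) : Set where
  field
    edge   : ∀ {a b} → M a b → Edge d a b
    unique : ∀ {x y z} → (M x y ⊎ M y x) → (M x z ⊎ M z x) → y ≡ z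

-- matching state insert(i,v): x is matched to (x_0,…,x_i,v,x_{i+1},…,x_k)
StateIns : ∀ {n} → (List (Fin n) → List (Fin n) → Set) → List (Fin n) → ℕ → Fin n → Set
StateIns M x i v = M (ins x (suc i) v) x

StateDel : ∀ {n} → (List (Fin n) → List (Fin n) → Set) → List (Fin n) → ℕ → Set
StateDel M x i = M x (del x i)

SamePrefix : ∀ {A : Set} → List A → ℕ → List A → Set
SamePrefix x i y = IsSeq y × (suc (suc i) ≤ length x) × ∃ λ ys → y ≡ take (suc (suc i)) x ++ ys

record IsPrefixMatching {n} (d : Fin n → Fin n → ℕ) (M : List (Fin n) → List (Fin n) → Set) : Set where
  field
    matching : IsMatching d M
    prefIns  : ∀ x i v → IsSeq x → StateIns M x i v → ∀ y → SamePrefix x i y → StateIns M y i v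
    prefDel  : ∀ x i → IsSeq x → StateDel M x i → ∀ y → SamePrefix x i y → StateDel M y i

-- The only facts used are that a sequence is never matched both to a longer and to a shorter
-- one (lengths differ by one along each matched edge) and the prefix property.
-- If d(i+1) = c(i) + 1 then b(i+1) = b(i) would be matched to a(i+1). If d(i+1) ≥ c(i) + 3,
-- then b(i+1) agrees up to index c(i) + 2 with a(i+1), which has state delete(c(i) + 1), so
-- b(i+1) is matched downwards as well as to a(i+2). If d(i) ≥ c(i) + 2, then a(i) agrees up to
-- index c(i) + 1 with b(i), which has state insert(c(i), u(i)), so a(i) is matched upwards as
-- well as to b(i-1).
module Submission where

open import Defs
open import Data.Nat using (ℕ; suc; _+_; _≤_; _<_)
open import Data.Fin using (Fin)
open import Data.List using (List; length)
open import Data.Product using (_×_)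
open import Relation.Nullary using (¬_)
open import Relation.Binary.PropositionalEquality using (_≡_)

open import Data.Empty using (⊥)
open import Data.Nat using (zero; s≤s)
open import Data.Nat.Properties using (≮⇒≥; ≤-trans; n≤1+n; m≢1+n+m)
open import Data.List using ([]; _∷_; take; drop; _++_)
open import Data.List.Properties using (take++drop≡id)
open import Data.Product using (∃; _,_; proj₁; proj₂)
open import Data.Sum using (inj₁; inj₂)
open import Relation.Binary.PropositionalEquality using (refl; sym; trans; cong; subst)
open Relation.Binary.PropositionalEquality.≡-Reasoning

del-ins : ∀ {A : Set} (xs : List A) j v → j ≤ length xs → del (ins xs j v) j ≡ xs
del-ins xs       zero    v _       = refl
del-ins (x ∷ xs) (suc j) v (s≤s h) = cong (x ∷_) (del-ins xs j v h)

length-del : ∀ {A : Set} (xs : List A) i → i < length xs → length xs ≡ suc (length (del xs i))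
length-del (x ∷ xs) zero    _       = refl
length-del (x ∷ xs) (suc i) (s≤s h) = cong suc (length-del xs i h)

take-del : ∀ {A : Set} (xs : List A) j e → j ≤ e → take j (del xs e) ≡ take j xs
take-del xs       zero    e       _       = refl
take-del []       (suc j) e       _       = refl
take-del (x ∷ xs) (suc j) (suc e) (s≤s h) = cong (x ∷_) (take-del xs j e h)

samePrefix : ∀ {A : Set} {x y : List A} i → IsSeq y → suc (suc i) ≤ length x →
  take (suc (suc i)) y ≡ take (suc (suc i)) x → SamePrefix x i y
samePrefix {x = x} {y} i seqY len eq = seqY , len , drop (suc (suc i)) y , (begin
  y                                                        ≡⟨ take++drop≡id (suc (suc i)) y ⟨
  take (suc (suc i)) y ++ drop (suc (suc i)) y             ≡⟨ cong (_++ drop (suc (suc i)) y) eq ⟩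
  take (suc (suc i)) x ++ drop (suc (suc i)) y             ∎)

length-edge : ∀ {n} {d : Fin n → Fin n → ℕ} {a b} → Edge d a b → length a ≡ suc (length b)
length-edge {a = a} (_ , _ , i , _ , i+1<len , refl , _) = length-del a i (≤-trans (n≤1+n _) i+1<len)

matched-above-and-below : ∀ {n} {d : Fin n → Fin n → ℕ} {M} → IsMatching d M →
  ∀ {x y z} → M x y → M y z → ⊥
matched-above-and-below matching {x} {y} {z} Mxy Myz =
  m≢1+n+m (length z) {1} (begin
    length z          ≡⟨ cong length (unique (inj₂ Mxy) (inj₁ Myz)) ⟨
    length x          ≡⟨ length-edge (edge Mxy) ⟩
    suc (length y)    ≡⟨ cong suc (length-edge (edge Myz)) ⟩
    suc (suc (length z)) ∎)
  where open IsMatching matching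

module _ {n} {d : Fin n → Fin n → ℕ} {M} (prefixMatching : IsPrefixMatching d M) where
  open IsPrefixMatching prefixMatching

  deleted-from-StateDel-unmatched-above : ∀ {x y z j e} → IsSeq x → IsSeq y → y ≡ del x e →
    suc (suc j) ≤ e → suc (suc j) ≤ length x → StateDel M x j → ¬ M z y
  deleted-from-StateDel-unmatched-above {x} {y} {j = j} {e} seqX seqY refl j+2≤e len stateDel Mzy =
    matched-above-and-below matching Mzy
      (prefDel x j seqX stateDel y (samePrefix j seqY len (take-del x _ e j+2≤e)))

  StateIns-after-deletion-unmatched-below : ∀ {x y z j e v} → IsSeq x → IsSeq y → y ≡ del x e →
    suc (suc j) ≤ e → suc (suc j) ≤ length y → StateIns M y j v → ¬ M x z
  StateIns-after-deletion-unmatched-below {x} {y} {j = j} {e} {v} seqX seqY refl j+2≤e len stateIns Mxz =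
    matched-above-and-below matching
      (prefIns y j v seqY stateIns x (samePrefix j seqX len (sym (take-del x _ e j+2≤e)))) Mxz

periodic-predecessor : ∀ {A : Set} (f : ℕ → A) p → 1 ≤ p → (∀ i → f (i + p) ≡ f i) →
  ∀ i → ∃ λ j → f (suc j) ≡ f i
periodic-predecessor f (suc q) _ periodic zero    = q , periodic zero
periodic-predecessor f p       _ periodic (suc i) = i , refl

lemma3p7 : ∀ {n} (G : Graph n) → Connected G →
    (d : Fin n → Fin n → ℕ) → IsShortestPathMetric G d →
    (M : List (Fin n) → List (Fin n) → Set) → IsPrefixMatching d M →
    (k p : ℕ) → 1 ≤ p →
    (a b : ℕ → List (Fin n)) (dd cc : ℕ → ℕ) (u : ℕ → Fin n) →
    (∀ i → a (i + p) ≡ a i) → (∀ i → b (i + p) ≡ b i) →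
    (∀ i → dd (i + p) ≡ dd i) → (∀ i → cc (i + p) ≡ cc i) → (∀ i → u (i + p) ≡ u i) →
    (∀ i → length (a i) ≡ suc k) → (∀ i → length (b i) ≡ k) →
    (∀ i → Edge d (a i) (b i)) → (∀ i → ¬ M (a i) (b i)) →
    (∀ i → 1 ≤ dd i) → (∀ i → dd i < k) → (∀ i → b i ≡ del (a i) (dd i)) →
    (∀ i → M (a (suc i)) (b i)) → (∀ i → suc (cc i) < k) →
    (∀ i → a (suc i) ≡ ins (b i) (suc (cc i)) (u i)) →
    ∀ i → (¬ dd (suc i) ≡ suc (cc i)) × (dd (suc i) ≤ suc (suc (cc i))) × (dd i ≤ suc (cc i))
lemma3p7 _ _ _ _ M prefixMatching _ p p≥1 a b dd cc u periodic _ _ _ _ la lb edge unmatched _ _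
  bdel matched c+1<k ains i = dd[i+1]≢c+1 , ≮⇒≥ c+2≮dd[i+1] , ≮⇒≥ c+1≮dd[i]
  where
  seqA : ∀ j → IsSeq (a j)
  seqA j = proj₁ (edge j)

  seqB : ∀ j → IsSeq (b j)
  seqB j = proj₁ (proj₂ (edge j))

  del-a[i+1] : del (a (suc i)) (suc (cc i)) ≡ b i
  del-a[i+1] = trans (cong (λ x → del x (suc (cc i))) (ains i))
    (del-ins (b i) _ (u i) (subst (_ ≤_) (sym (lb i)) (≤-trans (n≤1+n _) (c+1<k i))))

  dd[i+1]≢c+1 : ¬ dd (suc i) ≡ suc (cc i)
  dd[i+1]≢c+1 dd≡c+1 = unmatched (suc i) (subst (M (a (suc i))) (sym b[i+1]≡b[i]) (matched i))
    where
    b[i+1]≡b[i] : b (suc i) ≡ b i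
    b[i+1]≡b[i] = trans (bdel (suc i)) (trans (cong (del (a (suc i))) dd≡c+1) del-a[i+1])

  c+2≮dd[i+1] : ¬ suc (suc (cc i)) < dd (suc i)
  c+2≮dd[i+1] c+2<dd = deleted-from-StateDel-unmatched-above prefixMatching
    (seqA (suc i)) (seqB (suc i)) (bdel (suc i)) c+2<dd
    (subst (_ ≤_) (sym (la (suc i))) (s≤s (c+1<k i)))
    (subst (M (a (suc i))) (sym del-a[i+1]) (matched i)) (matched (suc i))

  c+1≮dd[i] : ¬ suc (cc i) < dd i
  c+1≮dd[i] c+1<dd with periodic-predecessor a p p≥1 periodic i
  ... | j , a[j+1]≡a[i] = StateIns-after-deletion-unmatched-below prefixMatching
    (seqA i) (seqB i) (bdel i) c+1<dd
    (subst (_ ≤_) (sym (lb i)) (c+1<k i))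
    (subst (λ x → M x (b i)) (ains i) (matched i))
    (subst (λ x → M x (b j)) a[j+1]≡a[i] (matched j))
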